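{- Let $n\geq 3$ and $m\geq 2n$ be integers, and let $S=\{i_1,i_2,\dots,i_{2n}\}$ be a $2n$-subset of $[m]$. Let $\jmath_S:\mathcal{F}_n^{[2n]}\to\mathcal{F}_n^{[m]}$ be the map $\{a_1,\dots,a_n\}\mapsto\{i_{a_1},\dots,i_{a_n}\}$. Let $\mathcal{A}_n$ be the collection of maximal antipode-free simplices of $\mathcal{VR}(\mathcal{F}_n^{[2n]};2(n-1))$, i.e. subsets of $\mathcal{F}_n^{[2n]}$ containing exactly one of $A$ and $[2n]\setminus A$ for every $A\in\mathcal{F}_n^{[2n]}$. Then there exists $\sigma\in\mathcal{A}_n$ such that $\jmath_S(\sigma)$ is a maximal simplex of $\mathcal{VR}(\mathcal{F}_n^{[m]};2(n-1))$ and the convex hull of $\jmath_S(\sigma)$ equals $\mathcal{VR}(\mathcal{F}_n^{S};2(n-1))$, the full subcomplex on the vertex set $\jmath_S(\mathcal{F}_n^{[2n]})$.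
   Context: $[m]=\{1,\dots,m\}$. For $T\subseteq[m]$ with $|T|\geq n$, $\mathcal{F}_n^{T}$ is the set of $n$-element subsets of $T$ with metric $d(A,B)=|A\triangle B|$. For a metric space $(X,d)$ and $r\ge 0$, $\mathcal{VR}(X;r)$ is the simplicial complex on $X$ whose simplices are the nonempty finite $\tau\subseteq X$ with $d(x,y)\leq r$ for all $x,y\in\tau$. A maximal simplex is one not properly contained in another simplex. For a simplex $\tau$ of $\mathcal{VR}(\mathcal{F}_n^{[m]};2(n-1))$, its convex hull is $\mathcal{VR}(\mathcal{F}_n^{U};2(n-1))$ where $U=\bigcup_{A\in\tau}A$. -}

module Defs where

open import Level using (0ℓ)
open import Data.Nat using (ℕ; _≤_)
open import Data.Fin using (Fin)
open import Data.Fin.Subset using (Subset; _∈_; _∉_; _∪_; _─_; ∁; ∣_∣)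
open import Data.Product using (Σ; ∃; _×_)
open import Data.Sum using (_⊎_)
open import Relation.Nullary using (¬_)
open import Relation.Unary using (Pred)
open import Relation.Binary.PropositionalEquality using (_≡_)

-- Vertices are subsets of [m] = Fin m (as 'Subset m').
-- A (finite) set of vertices is a predicate on Subset m (finiteness is automatic).

dist : ∀ {m} → Subset m → Subset m → ℕ
dist A B = ∣ (A ─ B) ∪ (B ─ A) ∣

Full : ∀ {m} → Pred (Fin m) 0ℓ
Full _ = Data.Unit.⊤
  where import Data.Unit

IsVRSimplex : ∀ {m} (n r : ℕ) (T : Pred (Fin m) 0ℓ) → Pred (Subset m) 0ℓ → Set
IsVRSimplex {m} n r T τ =
  (∃ λ A → τ A)
  × (∀ A → τ A → (∣ A ∣ ≡ n) × (∀ x → x ∈ A → T x))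
  × (∀ A B → τ A → τ B → dist A B ≤ r)

IsMaximalVRSimplex : ∀ {m} (n r : ℕ) (T : Pred (Fin m) 0ℓ) → Pred (Subset m) 0ℓ → Set₁
IsMaximalVRSimplex {m} n r T τ =
  IsVRSimplex n r T τ
  × (∀ (τ' : Pred (Subset m) 0ℓ) → IsVRSimplex n r T τ' →
       ¬ ((∀ A → τ A → τ' A) × (∃ λ B → τ' B × ¬ τ B)))

IsAntipodeFreeMax : ∀ {N} (n r : ℕ) → Pred (Subset N) 0ℓ → Set
IsAntipodeFreeMax n r σ =
  IsVRSimplex n r Full σ
  × (∀ A → ∣ A ∣ ≡ n → (σ A × ¬ σ (∁ A)) ⊎ (¬ σ A × σ (∁ A)))

-- B is the image j_S(A) of A ⊆ [N] under ι : [N] → [m] (a ↦ i_a).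
IsImage : ∀ {N m} → (Fin N → Fin m) → Subset N → Subset m → Set
IsImage ι A B = ∀ x → (x ∈ B → ∃ λ a → a ∈ A × ι a ≡ x) × ((∃ λ a → a ∈ A × ι a ≡ x) → x ∈ B)

jImage : ∀ {N m} → (Fin N → Fin m) → Pred (Subset N) 0ℓ → Pred (Subset m) 0ℓ
jImage ι σ B = ∃ λ A → σ A × IsImage ι A B

RangeOf : ∀ {N m} → (Fin N → Fin m) → Pred (Fin m) 0ℓ
RangeOf ι x = ∃ λ a → ι a ≡ x

Union : ∀ {m} → Pred (Subset m) 0ℓ → Pred (Fin m) 0ℓ
Union τ x = ∃ λ A → τ A × x ∈ A

module Submission where

-- The n-subsets of [2n] avoiding a point s form an antipode-free, hence pairwise
-- intersecting, family in which every (n+1)-set contains a member.  That is what makes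
-- the image under j_S maximal in VR(F_n^[m]): for an n-set B outside the image, its
-- preimage C has at most n points and is not a member, so some member misses C (∁ C if
-- |C| = n, a member inside ∁ C otherwise), and its image is at distance 2n from B.
-- But no member contains s, whereas the convex hull must be all of S.  So take an
-- n-set D₁ ∋ a avoiding s and D₂ = {a} ∪ (∁ D₁ ∖ {s}), which meets D₁ only in a, and
-- trade D₁, D₂ for their complements: these cover every point outside D₁ ∩ D₂ = {a},
-- and for n ≥ 3 some other member contains a.  An (n+1)-set R still contains a member:
-- an n-subset of R ∖ {s} through a point of D₁ ∖ {a} and a point outside D₁ is neither
-- D₁ nor D₂, and when there is none, R is {s} ∪ D₁ ⊇ ∁ D₂ or {a} ∪ ∁ D₁.

open import Level using (0ℓ)
open import Data.Bool using (true; false) renaming (_≟_ to _≟ᵇ_)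
open import Data.Nat using (ℕ; zero; suc; _≤_; _<_; _+_; _*_; _∸_; z≤n; s≤s)
open import Data.Nat.Properties hiding (suc-injective)
open import Data.Nat.Tactic.RingSolver using (solve-∀)
open import Data.Fin using (Fin; zero; suc)
open import Data.Fin.Subset
open import Data.Fin.Subset.Properties
import Algebra.Lattice.Properties.BooleanAlgebra as BooleanAlgebraProperties
open import Data.Vec using ([]; _∷_; here; there; lookup; tabulate)
open import Data.Vec.Properties using (lookup∘tabulate; []=⇒lookup; lookup⇒[]=; ≡-dec)
open import Data.Fin.Properties using (suc-injective; any?) renaming (_≟_ to _≟ᶠ_)
open import Function.Definitions using (Injective)
open import Function using (_∘_)
open import Data.Product using (Σ; ∃; _×_; _,_; proj₁; proj₂)
open import Data.Sum using (_⊎_; inj₁; inj₂; [_,_]′)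
open import Relation.Nullary using (¬_; Dec; yes; no; contradiction; ¬?)
open import Relation.Nullary.Decidable using (_×-dec_; _⊎-dec_)
open import Relation.Unary using (Pred)
open import Relation.Binary.Definitions using (DecidableEquality)
open import Relation.Binary.PropositionalEquality
open import Defs

private variable
  m N : ℕ

-- Finite subsets

∁-involutive : (p : Subset N) → ∁ (∁ p) ≡ p
∁-involutive {N} = BooleanAlgebraProperties.¬-involutive (∪-∩-booleanAlgebra N)

x∈p─q⁻ : ∀ {x : Fin N} (p q : Subset N) → x ∈ p ─ q → x ∈ p × x ∉ q
x∈p─q⁻ (_ ∷ p) (_ ∷ q) (there x∈p─q) with x∈p─q⁻ p q x∈p─q
... | x∈p , x∉q = there x∈p , λ { (there x∈q) → x∉q x∈q }
x∈p─q⁻ (true ∷ p) (false ∷ q) here = here , λ ()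

x∉p⇒∣⁅x⁆∪p∣≡1+∣p∣ : ∀ (x : Fin N) (p : Subset N) → x ∉ p → ∣ ⁅ x ⁆ ∪ p ∣ ≡ suc ∣ p ∣
x∉p⇒∣⁅x⁆∪p∣≡1+∣p∣ zero    (true ∷ p)  x∉p = contradiction here x∉p
x∉p⇒∣⁅x⁆∪p∣≡1+∣p∣ zero    (false ∷ p) x∉p = cong (suc ∘ ∣_∣) (∪-identityˡ p)
x∉p⇒∣⁅x⁆∪p∣≡1+∣p∣ (suc x) (true ∷ p)  x∉p = cong suc (x∉p⇒∣⁅x⁆∪p∣≡1+∣p∣ x p (x∉p ∘ there))
x∉p⇒∣⁅x⁆∪p∣≡1+∣p∣ (suc x) (false ∷ p) x∉p = x∉p⇒∣⁅x⁆∪p∣≡1+∣p∣ x p (x∉p ∘ there)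

∣p∪q∣≤∣p∣+∣q∣ : (p q : Subset N) → ∣ p ∪ q ∣ ≤ ∣ p ∣ + ∣ q ∣
∣p∪q∣≤∣p∣+∣q∣ []          []          = z≤n
∣p∪q∣≤∣p∣+∣q∣ (true ∷ p)  (true ∷ q)  = s≤s (≤-trans (∣p∪q∣≤∣p∣+∣q∣ p q) (+-monoʳ-≤ ∣ p ∣ (n≤1+n ∣ q ∣)))
∣p∪q∣≤∣p∣+∣q∣ (true ∷ p)  (false ∷ q) = s≤s (∣p∪q∣≤∣p∣+∣q∣ p q)
∣p∪q∣≤∣p∣+∣q∣ (false ∷ p) (true ∷ q)  = ≤-trans (s≤s (∣p∪q∣≤∣p∣+∣q∣ p q)) (≤-reflexive (sym (+-suc ∣ p ∣ ∣ q ∣)))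
∣p∪q∣≤∣p∣+∣q∣ (false ∷ p) (false ∷ q) = ∣p∪q∣≤∣p∣+∣q∣ p q

∣p∣≤1+∣p-x∣ : (p : Subset N) (x : Fin N) → ∣ p ∣ ≤ suc ∣ p - x ∣
∣p∣≤1+∣p-x∣ (true ∷ p)  zero    = s≤s (≤-reflexive (cong ∣_∣ (sym (p─⊥≡p p))))
∣p∣≤1+∣p-x∣ (false ∷ p) zero    = m≤n⇒m≤1+n (≤-reflexive (cong ∣_∣ (sym (p─⊥≡p p))))
∣p∣≤1+∣p-x∣ (true ∷ p)  (suc x) = s≤s (∣p∣≤1+∣p-x∣ p x)
∣p∣≤1+∣p-x∣ (false ∷ p) (suc x) = ∣p∣≤1+∣p-x∣ p x

x∈p⇒1+∣p-x∣≡∣p∣ : ∀ {p : Subset N} {x} → x ∈ p → suc ∣ p - x ∣ ≡ ∣ p ∣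
x∈p⇒1+∣p-x∣≡∣p∣ {p = p} {x} x∈p = ≤-antisym (x∈p⇒∣p-x∣<∣p∣ x∈p) (∣p∣≤1+∣p-x∣ p x)

∣p∣<∣q∣⇒Nonempty[q─p] : ∀ {p q : Subset N} → ∣ p ∣ < ∣ q ∣ → Nonempty (q ─ p)
∣p∣<∣q∣⇒Nonempty[q─p] {p = p} {q} ∣p∣<∣q∣ with nonempty? (q ─ p)
... | yes x∈q─p = x∈q─p
... | no  q─p-empty = contradiction (p⊆q⇒∣p∣≤∣q∣ q⊆p) (<⇒≱ ∣p∣<∣q∣)
  where
  q⊆p : q ⊆ p
  q⊆p {x} x∈q with x ∈? p
  ... | yes x∈p = x∈p
  ... | no  x∉p = contradiction (x , x∈p∧x∉q⇒x∈p─q x∈q x∉p) q─p-empty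

p⊆q⇒∣q∣≤∣p∣⇒p≡q : ∀ {p q : Subset N} → p ⊆ q → ∣ q ∣ ≤ ∣ p ∣ → p ≡ q
p⊆q⇒∣q∣≤∣p∣⇒p≡q {p = p} {q} p⊆q ∣q∣≤∣p∣ = ⊆-antisym p⊆q q⊆p
  where
  q⊆p : q ⊆ p
  q⊆p {x} x∈q with x ∈? p
  ... | yes x∈p = x∈p
  ... | no  x∉p = contradiction ∣q∣≤∣p∣ (<⇒≱ (p⊂q⇒∣p∣<∣q∣ (p⊆q , x , x∈q , x∉p)))

x∈p⇒⁅x⁆⊆p : ∀ {x} {p : Subset N} → x ∈ p → ⁅ x ⁆ ⊆ p
x∈p⇒⁅x⁆⊆p {x = x} {p} x∈p y∈⁅x⁆ = subst (_∈ p) (sym (x∈⁅y⁆⇒x≡y x y∈⁅x⁆)) x∈p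

∪-lub : ∀ {p q r : Subset N} → p ⊆ r → q ⊆ r → p ∪ q ⊆ r
∪-lub {p = p} {q} p⊆r q⊆r x∈p∪q = [ p⊆r , q⊆r ]′ (x∈p∪q⁻ p q x∈p∪q)

1<∣p∣⇒∃[y∈p]y≢x : ∀ {p : Subset N} x → 1 < ∣ p ∣ → ∃ λ y → y ∈ p × y ≢ x
1<∣p∣⇒∃[y∈p]y≢x {p = p} x 1<∣p∣
  with y , y∈p─⁅x⁆ ← ∣p∣<∣q∣⇒Nonempty[q─p] (subst (_< ∣ p ∣) (sym (∣⁅x⁆∣≡1 x)) 1<∣p∣)
  with y∈p , y∉⁅x⁆ ← x∈p─q⁻ p ⁅ x ⁆ y∈p─⁅x⁆
  = y , y∈p , x∉⁅y⁆⇒x≢y y∉⁅x⁆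

q⊆⁅x⁆∪p⇒∣p∣<∣q∣⇒⁅x⁆∪p⊆q : ∀ {x} {p q : Subset N} → x ∉ p → q ⊆ ⁅ x ⁆ ∪ p → ∣ p ∣ < ∣ q ∣ → ⁅ x ⁆ ∪ p ⊆ q
q⊆⁅x⁆∪p⇒∣p∣<∣q∣⇒⁅x⁆∪p⊆q {x = x} {p} x∉p q⊆⁅x⁆∪p ∣p∣<∣q∣ = ⊆-reflexive (sym (p⊆q⇒∣q∣≤∣p∣⇒p≡q q⊆⁅x⁆∪p
  (subst (_≤ _) (sym (x∉p⇒∣⁅x⁆∪p∣≡1+∣p∣ x p x∉p)) ∣p∣<∣q∣)))

∃-subset-between : ∀ {P Q : Subset N} k → P ⊆ Q → ∣ P ∣ ≤ k → k ≤ ∣ Q ∣ →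
                   ∃ λ A → P ⊆ A × A ⊆ Q × ∣ A ∣ ≡ k
∃-subset-between {P = []} {[]} zero _ _ _ = [] , (λ ()) , (λ ()) , refl
∃-subset-between {P = true ∷ P} {true ∷ Q} (suc k) P⊆Q (s≤s ∣P∣≤k) (s≤s k≤∣Q∣)
  with A , P⊆A , A⊆Q , ∣A∣≡k ← ∃-subset-between k (drop-∷-⊆ P⊆Q) ∣P∣≤k k≤∣Q∣
  = true ∷ A , in⊆in P⊆A , in⊆in A⊆Q , cong suc ∣A∣≡k
∃-subset-between {P = true ∷ P} {false ∷ Q} k P⊆Q _ _ with () ← P⊆Q here
∃-subset-between {P = false ∷ P} {false ∷ Q} k P⊆Q ∣P∣≤k k≤∣Q∣
  with A , P⊆A , A⊆Q , ∣A∣≡k ← ∃-subset-between k (drop-∷-⊆ P⊆Q) ∣P∣≤k k≤∣Q∣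
  = false ∷ A , s⊆s P⊆A , s⊆s A⊆Q , ∣A∣≡k
∃-subset-between {P = false ∷ P} {true ∷ Q} k P⊆Q ∣P∣≤k k≤1+∣Q∣ with k ≤? ∣ Q ∣
... | yes k≤∣Q∣
  with A , P⊆A , A⊆Q , ∣A∣≡k ← ∃-subset-between k (drop-∷-⊆ P⊆Q) ∣P∣≤k k≤∣Q∣
  = false ∷ A , s⊆s P⊆A , out⊆ A⊆Q , ∣A∣≡k
... | no k≰∣Q∣
  with A , P⊆A , A⊆Q , ∣A∣≡∣Q∣ ← ∃-subset-between ∣ Q ∣ (drop-∷-⊆ P⊆Q) (p⊆q⇒∣p∣≤∣q∣ (drop-∷-⊆ P⊆Q)) ≤-refl
  = true ∷ A , out⊆ P⊆A , in⊆in A⊆Q , trans (cong suc ∣A∣≡∣Q∣) (≤-antisym (≰⇒> k≰∣Q∣) k≤1+∣Q∣)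

module _ {n : ℕ} (p : Subset (2 * n)) where

  ∣p∣≡n⇒∣∁p∣≡n : ∣ p ∣ ≡ n → ∣ ∁ p ∣ ≡ n
  ∣p∣≡n⇒∣∁p∣≡n ∣p∣≡n = begin
    ∣ ∁ p ∣          ≡⟨ ∣∁p∣≡n∸∣p∣ p ⟩
    2 * n ∸ ∣ p ∣    ≡⟨ cong (2 * n ∸_) ∣p∣≡n ⟩
    n + (n + 0) ∸ n  ≡⟨ m+n∸m≡n n (n + 0) ⟩
    n + 0            ≡⟨ +-identityʳ n ⟩
    n                ∎
    where open ≡-Reasoning

  ∣p∣<n⇒n<∣∁p∣ : ∣ p ∣ < n → n < ∣ ∁ p ∣
  ∣p∣<n⇒n<∣∁p∣ ∣p∣<n = begin-strict
    n              <⟨ m+n≤o⇒m≤o∸n (suc n) 1+n+∣p∣≤2*n ⟩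
    2 * n ∸ ∣ p ∣  ≡⟨ ∣∁p∣≡n∸∣p∣ p ⟨
    ∣ ∁ p ∣        ∎
    where
    open ≤-Reasoning
    1+n+∣p∣≤2*n : suc n + ∣ p ∣ ≤ 2 * n
    1+n+∣p∣≤2*n = begin
      suc n + ∣ p ∣  ≡⟨ +-suc n ∣ p ∣ ⟨
      n + suc ∣ p ∣  ≤⟨ +-monoʳ-≤ n ∣p∣<n ⟩
      n + n          ≡⟨ cong (n +_) (+-identityʳ n) ⟨
      2 * n          ∎

∃-half : ∀ n → 1 ≤ n → ∃ λ (D : Subset (2 * n)) → ∣ D ∣ ≡ n × Nonempty D × Nonempty (∁ D)
∃-half n 1≤n = half (∃-subset-between {P = ⊥} {Q = ⊤} n ⊥⊆ (≤-trans (≤-reflexive (∣⊥∣≡0 (2 * n))) z≤n) n≤∣⊤∣)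
  where
  n≤∣⊤∣ : n ≤ ∣ ⊤ {2 * n} ∣
  n≤∣⊤∣ = ≤-trans (m≤m+n n (n + 0)) (≤-reflexive (sym (∣⊤∣≡n (2 * n))))
  nonempty : ∀ {p : Subset (2 * n)} → ∣ p ∣ ≡ n → Nonempty p
  nonempty {p} ∣p∣≡n = subst Nonempty (p─⊥≡p p)
    (∣p∣<∣q∣⇒Nonempty[q─p] (subst₂ _<_ (sym (∣⊥∣≡0 (2 * n))) (sym ∣p∣≡n) 1≤n))
  half : (∃ λ D → ⊥ ⊆ D × D ⊆ ⊤ × ∣ D ∣ ≡ n) → ∃ λ D → ∣ D ∣ ≡ n × Nonempty D × Nonempty (∁ D)
  half (D , _ , _ , ∣D∣≡n) = D , ∣D∣≡n , nonempty ∣D∣≡n , nonempty (∣p∣≡n⇒∣∁p∣≡n D ∣D∣≡n)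

-- Symmetric-difference distance

∣p∣+∣q∣≡dist+2*∣p∩q∣ : (p q : Subset N) → ∣ p ∣ + ∣ q ∣ ≡ dist p q + 2 * ∣ p ∩ q ∣
∣p∣+∣q∣≡dist+2*∣p∩q∣ []          []          = refl
∣p∣+∣q∣≡dist+2*∣p∩q∣ (true ∷ p)  (true ∷ q)  = begin
  suc ∣ p ∣ + suc ∣ q ∣                 ≡⟨ cong suc (+-suc ∣ p ∣ ∣ q ∣) ⟩
  2 + (∣ p ∣ + ∣ q ∣)                   ≡⟨ cong (2 +_) (∣p∣+∣q∣≡dist+2*∣p∩q∣ p q) ⟩
  2 + (dist p q + 2 * ∣ p ∩ q ∣)        ≡⟨ shift (dist p q) ∣ p ∩ q ∣ ⟩
  dist p q + 2 * suc ∣ p ∩ q ∣          ∎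
  where
  open ≡-Reasoning
  shift : ∀ d k → 2 + (d + 2 * k) ≡ d + 2 * suc k
  shift = solve-∀
∣p∣+∣q∣≡dist+2*∣p∩q∣ (true ∷ p)  (false ∷ q) = cong suc (∣p∣+∣q∣≡dist+2*∣p∩q∣ p q)
∣p∣+∣q∣≡dist+2*∣p∩q∣ (false ∷ p) (true ∷ q)  = trans (+-suc ∣ p ∣ ∣ q ∣) (cong suc (∣p∣+∣q∣≡dist+2*∣p∩q∣ p q))
∣p∣+∣q∣≡dist+2*∣p∩q∣ (false ∷ p) (false ∷ q) = ∣p∣+∣q∣≡dist+2*∣p∩q∣ p q

module _ {n : ℕ} {p q : Subset N} (∣p∣≡n : ∣ p ∣ ≡ n) (∣q∣≡n : ∣ q ∣ ≡ n) where

  dist+2*∣p∩q∣≡2*n : dist p q + 2 * ∣ p ∩ q ∣ ≡ 2 * n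
  dist+2*∣p∩q∣≡2*n = begin
    dist p q + 2 * ∣ p ∩ q ∣ ≡⟨ ∣p∣+∣q∣≡dist+2*∣p∩q∣ p q ⟨
    ∣ p ∣ + ∣ q ∣            ≡⟨ cong₂ _+_ ∣p∣≡n ∣q∣≡n ⟩
    n + n                    ≡⟨ cong (n +_) (+-identityʳ n) ⟨
    2 * n                    ∎
    where open ≡-Reasoning

  Nonempty[p∩q]⇒dist≤2*[n∸1] : Nonempty (p ∩ q) → dist p q ≤ 2 * (n ∸ 1)
  Nonempty[p∩q]⇒dist≤2*[n∸1] (x , x∈p∩q) = begin
    dist p q                            ≡⟨ m+n∸n≡m (dist p q) (2 * ∣ p ∩ q ∣) ⟨
    dist p q + 2 * ∣ p ∩ q ∣ ∸ 2 * ∣ p ∩ q ∣ ≡⟨ cong (_∸ 2 * ∣ p ∩ q ∣) dist+2*∣p∩q∣≡2*n ⟩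
    2 * n ∸ 2 * ∣ p ∩ q ∣               ≤⟨ ∸-monoʳ-≤ (2 * n) (*-monoʳ-≤ 2 1≤∣p∩q∣) ⟩
    2 * n ∸ 2 * 1                       ≡⟨ *-distribˡ-∸ 2 n 1 ⟨
    2 * (n ∸ 1)                         ∎
    where
    open ≤-Reasoning
    1≤∣p∩q∣ : 1 ≤ ∣ p ∩ q ∣
    1≤∣p∩q∣ = ≤-<-trans z≤n (x∈p⇒∣p-x∣<∣p∣ x∈p∩q)

  Empty[p∩q]⇒2*[n∸1]<dist : 1 ≤ n → Empty (p ∩ q) → 2 * (n ∸ 1) < dist p q
  Empty[p∩q]⇒2*[n∸1]<dist 1≤n p∩q-empty = begin-strict
    2 * (n ∸ 1)              <⟨ *-monoʳ-< 2 (∸-monoʳ-< {o = 0} ≤-refl 1≤n) ⟩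
    2 * n                    ≡⟨ dist+2*∣p∩q∣≡2*n ⟨
    dist p q + 2 * ∣ p ∩ q ∣ ≡⟨ cong (λ k → dist p q + 2 * k) ∣p∩q∣≡0 ⟩
    dist p q + 0             ≡⟨ +-identityʳ (dist p q) ⟩
    dist p q                 ∎
    where
    open ≤-Reasoning
    ∣p∩q∣≡0 : ∣ p ∩ q ∣ ≡ 0
    ∣p∩q∣≡0 = trans (cong ∣_∣ (Empty-unique p∩q-empty)) (∣⊥∣≡0 N)

-- Images and preimages under an injection

image : (Fin N → Fin m) → Subset N → Subset m
image ι []          = ⊥
image ι (true ∷ A)  = ⁅ ι zero ⁆ ∪ image (ι ∘ suc) A
image ι (false ∷ A) = image (ι ∘ suc) A

image⁺ : ∀ (ι : Fin N → Fin m) {A a} → a ∈ A → ι a ∈ image ι A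
image⁺ ι {true ∷ A}  here        = x∈p∪q⁺ (inj₁ (x∈⁅x⁆ (ι zero)))
image⁺ ι {true ∷ A}  (there a∈A) = x∈p∪q⁺ (inj₂ (image⁺ (ι ∘ suc) a∈A))
image⁺ ι {false ∷ A} (there a∈A) = image⁺ (ι ∘ suc) a∈A

image⁻ : ∀ (ι : Fin N → Fin m) A {x} → x ∈ image ι A → ∃ λ a → a ∈ A × ι a ≡ x
image⁻ ι [] x∈⊥ = contradiction x∈⊥ ∉⊥
image⁻ ι (true ∷ A) {x} x∈ with x∈p∪q⁻ ⁅ ι zero ⁆ (image (ι ∘ suc) A) x∈
... | inj₁ x∈⁅ι0⁆ = zero , here , sym (x∈⁅y⁆⇒x≡y (ι zero) x∈⁅ι0⁆)
... | inj₂ x∈rest with a , a∈A , ιa≡x ← image⁻ (ι ∘ suc) A x∈rest = suc a , there a∈A , ιa≡x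
image⁻ ι (false ∷ A) x∈ with a , a∈A , ιa≡x ← image⁻ (ι ∘ suc) A x∈ = suc a , there a∈A , ιa≡x

∣image∣≡∣∣ : ∀ {ι : Fin N → Fin m} → Injective _≡_ _≡_ ι → ∀ A → ∣ image ι A ∣ ≡ ∣ A ∣
∣image∣≡∣∣ {m = m} _ [] = ∣⊥∣≡0 m
∣image∣≡∣∣ {ι = ι} inj (true ∷ A) =
  trans (x∉p⇒∣⁅x⁆∪p∣≡1+∣p∣ (ι zero) (image (ι ∘ suc) A) ι0∉) (cong suc (∣image∣≡∣∣ (suc-injective ∘ inj) A))
  where
  ι0∉ : ι zero ∉ image (ι ∘ suc) A
  ι0∉ ι0∈ with _ , _ , ιa≡ι0 ← image⁻ (ι ∘ suc) A ι0∈ with () ← inj ιa≡ι0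
∣image∣≡∣∣ inj (false ∷ A) = ∣image∣≡∣∣ (suc-injective ∘ inj) A

IsImage-image : ∀ (ι : Fin N → Fin m) A → IsImage ι A (image ι A)
IsImage-image ι A x = image⁻ ι A , λ { (a , a∈A , refl) → image⁺ ι a∈A }

IsImage⇒≡image : ∀ {ι : Fin N → Fin m} {A B} → IsImage ι A B → B ≡ image ι A
IsImage⇒≡image {ι = ι} {A} B-image = ⊆-antisym
  (λ {x} x∈B → proj₂ (IsImage-image ι A x) (proj₁ (B-image x) x∈B))
  (λ {x} x∈image → proj₂ (B-image x) (image⁻ ι A x∈image))

preimage : (Fin N → Fin m) → Subset m → Subset N
preimage ι B = tabulate (λ a → lookup B (ι a))

preimage⁺ : ∀ {ι : Fin N → Fin m} {B a} → ι a ∈ B → a ∈ preimage ι B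
preimage⁺ {ι = ι} {B} {a} ιa∈B =
  lookup⇒[]= a _ (trans (lookup∘tabulate (lookup B ∘ ι) a) ([]=⇒lookup ιa∈B))

preimage⁻ : ∀ (ι : Fin N → Fin m) B {a} → a ∈ preimage ι B → ι a ∈ B
preimage⁻ ι B {a} a∈ =
  lookup⇒[]= (ι a) B (trans (sym (lookup∘tabulate (lookup B ∘ ι) a)) ([]=⇒lookup a∈))

image-preimage⊆ : ∀ (ι : Fin N → Fin m) B → image ι (preimage ι B) ⊆ B
image-preimage⊆ ι B x∈ with _ , a∈ , refl ← image⁻ ι (preimage ι B) x∈ = preimage⁻ ι B a∈

-- Vietoris–Rips simplices of intersecting families

Intersecting : Pred (Subset m) 0ℓ → Set
Intersecting τ = ∀ {A B} → τ A → τ B → Nonempty (A ∩ B)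

module _ {n : ℕ} {T : Pred (Fin m) 0ℓ} {τ : Pred (Subset m) 0ℓ} where

  intersecting⇒IsVRSimplex : ∃ τ → (∀ A → τ A → ∣ A ∣ ≡ n × (∀ x → x ∈ A → T x)) →
                             Intersecting τ → IsVRSimplex n (2 * (n ∸ 1)) T τ
  intersecting⇒IsVRSimplex inhabited members meet = inhabited , members ,
    λ A B τA τB → Nonempty[p∩q]⇒dist≤2*[n∸1] (proj₁ (members A τA)) (proj₁ (members B τB)) (meet τA τB)

  IsVRSimplex-mono : ∀ {r} {T′ : Pred (Fin m) 0ℓ} → (∀ x → T x → T′ x) →
                     IsVRSimplex n r T τ → IsVRSimplex n r T′ τ
  IsVRSimplex-mono T⊆T′ (inhabited , members , close) =
    inhabited , (λ A τA → proj₁ (members A τA) , λ x x∈A → T⊆T′ x (proj₂ (members A τA) x x∈A)) , close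

  far-outsiders⇒IsMaximalVRSimplex : ∀ {r} → IsVRSimplex n r T τ →
    (∀ B → ∣ B ∣ ≡ n → ¬ τ B → ∃ λ A → τ A × r < dist A B) → IsMaximalVRSimplex n r T τ
  far-outsiders⇒IsMaximalVRSimplex simplex far = simplex , λ where
    τ′ (_ , members′ , close′) (τ⊆τ′ , B , τ′B , ¬τB) →
      let A , τA , r<dist = far B (proj₁ (members′ B τ′B)) ¬τB
      in  <⇒≱ r<dist (close′ A B (τ⊆τ′ A τA) τ′B)

-- Antipodal families and their images

module Antipodal {n : ℕ} {σ : Pred (Subset (2 * n)) 0ℓ}
                 (σ-card : ∀ {A} → σ A → ∣ A ∣ ≡ n)
                 (σ⊎σ∁ : ∀ {A} → ∣ A ∣ ≡ n → σ A ⊎ σ (∁ A))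
                 (σ⇒¬σ∁ : ∀ {A} → σ A → ¬ σ (∁ A)) where

  exactly-one : ∀ A → ∣ A ∣ ≡ n → (σ A × ¬ σ (∁ A)) ⊎ (¬ σ A × σ (∁ A))
  exactly-one A ∣A∣≡n with σ⊎σ∁ ∣A∣≡n
  ... | inj₁ σA  = inj₁ (σA , σ⇒¬σ∁ σA)
  ... | inj₂ σ∁A = inj₂ ((λ σA → σ⇒¬σ∁ σA σ∁A) , σ∁A)

  intersecting : Intersecting σ
  intersecting {A} {B} σA σB with nonempty? (A ∩ B)
  ... | yes A∩B-nonempty = A∩B-nonempty
  ... | no  A∩B-empty    = contradiction (subst σ A≡∁B σA) (σ⇒¬σ∁ σB)
    where
    A⊆∁B : A ⊆ ∁ B
    A⊆∁B x∈A = x∉p⇒x∈∁p (λ x∈B → A∩B-empty (_ , x∈p∩q⁺ (x∈A , x∈B)))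
    A≡∁B : A ≡ ∁ B
    A≡∁B = p⊆q⇒∣q∣≤∣p∣⇒p≡q A⊆∁B (≤-reflexive (trans (∣p∣≡n⇒∣∁p∣≡n B (σ-card σB)) (sym (σ-card σA))))

  ∃-member⊆∁ : (∀ R → n < ∣ R ∣ → ∃ λ A → σ A × A ⊆ R) →
               ∀ C → ∣ C ∣ ≤ n → ¬ σ C → ∃ λ A → σ A × A ⊆ ∁ C
  ∃-member⊆∁ ∃-member⊆ C ∣C∣≤n ¬σC with m≤n⇒m<n∨m≡n ∣C∣≤n
  ... | inj₁ ∣C∣<n = ∃-member⊆ (∁ C) (∣p∣<n⇒n<∣∁p∣ C ∣C∣<n)
  ... | inj₂ ∣C∣≡n with σ⊎σ∁ ∣C∣≡n
  ...   | inj₁ σC  = contradiction σC ¬σC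
  ...   | inj₂ σ∁C = ∁ C , σ∁C , ⊆-refl

module _ {ι : Fin N → Fin m} {σ : Pred (Subset N) 0ℓ} where

  jImage-intersecting : Intersecting σ → Intersecting (jImage ι σ)
  jImage-intersecting meet (A , σA , B-image) (A′ , σA′ , B′-image)
    with x , x∈A∩A′ ← meet σA σA′
    with x∈A , x∈A′ ← x∈p∩q⁻ A A′ x∈A∩A′
    = ι x , x∈p∩q⁺ (proj₂ (B-image (ι x)) (x , x∈A , refl) , proj₂ (B′-image (ι x)) (x , x∈A′ , refl))

  Union-jImage⇒RangeOf : ∀ x → Union (jImage ι σ) x → RangeOf ι x
  Union-jImage⇒RangeOf x (B , (A , _ , B-image) , x∈B) with a , _ , ιa≡x ← proj₁ (B-image x) x∈B = a , ιa≡x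

  RangeOf⇒Union-jImage : (∀ a → ∃ λ A → σ A × a ∈ A) → ∀ x → RangeOf ι x → Union (jImage ι σ) x
  RangeOf⇒Union-jImage covers x (a , refl) with A , σA , a∈A ← covers a =
    image ι A , (A , σA , IsImage-image ι A) , image⁺ ι a∈A

module _ {n : ℕ} {ι : Fin N → Fin m} (ι-injective : Injective _≡_ _≡_ ι)
         {σ : Pred (Subset N) 0ℓ} (σ-card : ∀ {A} → σ A → ∣ A ∣ ≡ n) where

  jImage-card : ∀ {B} → jImage ι σ B → ∣ B ∣ ≡ n
  jImage-card {B} (A , σA , B-image) = begin
    ∣ B ∣           ≡⟨ cong ∣_∣ (IsImage⇒≡image B-image) ⟩
    ∣ image ι A ∣   ≡⟨ ∣image∣≡∣∣ ι-injective A ⟩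
    ∣ A ∣           ≡⟨ σ-card σA ⟩
    n               ∎
    where open ≡-Reasoning

  jImage-outsiders-far : 1 ≤ n → (∀ C → ∣ C ∣ ≤ n → ¬ σ C → ∃ λ A → σ A × A ⊆ ∁ C) →
                         ∀ B → ∣ B ∣ ≡ n → ¬ jImage ι σ B → ∃ λ A → jImage ι σ A × 2 * (n ∸ 1) < dist A B
  jImage-outsiders-far 1≤n ∃-member⊆∁ B ∣B∣≡n ¬jB = far (∃-member⊆∁ C ∣C∣≤n ¬σC)
    where
    C : Subset N
    C = preimage ι B
    ∣C∣≡∣image∣ : ∣ C ∣ ≡ ∣ image ι C ∣
    ∣C∣≡∣image∣ = sym (∣image∣≡∣∣ ι-injective C)
    ∣C∣≤n : ∣ C ∣ ≤ n
    ∣C∣≤n = subst (∣ C ∣ ≤_) ∣B∣≡n (≤-trans (≤-reflexive ∣C∣≡∣image∣) (p⊆q⇒∣p∣≤∣q∣ (image-preimage⊆ ι B)))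
    ¬σC : ¬ σ C
    ¬σC σC = ¬jB (C , σC , subst (IsImage ι C) image≡B (IsImage-image ι C))
      where
      image≡B : image ι C ≡ B
      image≡B = p⊆q⇒∣q∣≤∣p∣⇒p≡q (image-preimage⊆ ι B)
                  (≤-reflexive (trans ∣B∣≡n (trans (sym (σ-card σC)) ∣C∣≡∣image∣)))
    far : (∃ λ A → σ A × A ⊆ ∁ C) → ∃ λ A → jImage ι σ A × 2 * (n ∸ 1) < dist A B
    far (A , σA , A⊆∁C) = image ι A , (A , σA , IsImage-image ι A) ,
      Empty[p∩q]⇒2*[n∸1]<dist (trans (∣image∣≡∣∣ ι-injective A) (σ-card σA)) ∣B∣≡n 1≤n disjoint
      where
      disjoint : Empty (image ι A ∩ B)
      disjoint (x , x∈image∩B) with x∈image , x∈B ← x∈p∩q⁻ (image ι A) B x∈image∩B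
                               with a , a∈A , refl ← image⁻ ι A x∈image
        = x∈∁p⇒x∉p (A⊆∁C a∈A) (preimage⁺ x∈B)

-- The swapped star

module SwappedStar {n : ℕ} {s a : Fin (2 * n)} {D₁ : Subset (2 * n)}
                   (a∈D₁ : a ∈ D₁) (s∉D₁ : s ∉ D₁) (∣D₁∣≡n : ∣ D₁ ∣ ≡ n) where

  ∣∁D₁∣≡n : ∣ ∁ D₁ ∣ ≡ n
  ∣∁D₁∣≡n = ∣p∣≡n⇒∣∁p∣≡n D₁ ∣D₁∣≡n

  D₂ : Subset (2 * n)
  D₂ = ⁅ a ⁆ ∪ (∁ D₁ - s)

  ∣D₂∣≡n : ∣ D₂ ∣ ≡ n
  ∣D₂∣≡n = begin
    ∣ ⁅ a ⁆ ∪ (∁ D₁ - s) ∣ ≡⟨ x∉p⇒∣⁅x⁆∪p∣≡1+∣p∣ a (∁ D₁ - s) a∉∁D₁-s ⟩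
    suc ∣ ∁ D₁ - s ∣       ≡⟨ x∈p⇒1+∣p-x∣≡∣p∣ (x∉p⇒x∈∁p s∉D₁) ⟩
    ∣ ∁ D₁ ∣               ≡⟨ ∣∁D₁∣≡n ⟩
    n                      ∎
    where
    open ≡-Reasoning
    a∉∁D₁-s : a ∉ ∁ D₁ - s
    a∉∁D₁-s a∈ = x∈∁p⇒x∉p (proj₁ (x∈p─q⁻ (∁ D₁) ⁅ s ⁆ a∈)) a∈D₁

  s∉D₂ : s ∉ D₂
  s∉D₂ s∈D₂ with x∈p∪q⁻ ⁅ a ⁆ (∁ D₁ - s) s∈D₂
  ... | inj₁ s∈⁅a⁆ = s∉D₁ (subst (_∈ D₁) (sym (x∈⁅y⁆⇒x≡y a s∈⁅a⁆)) a∈D₁)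
  ... | inj₂ s∈∁D₁-s = proj₂ (x∈p─q⁻ (∁ D₁) ⁅ s ⁆ s∈∁D₁-s) (x∈⁅x⁆ s)

  ∈D₁∩D₂⇒≡a : ∀ {x} → x ∈ D₁ → x ∈ D₂ → x ≡ a
  ∈D₁∩D₂⇒≡a x∈D₁ x∈D₂ with x∈p∪q⁻ ⁅ a ⁆ (∁ D₁ - s) x∈D₂
  ... | inj₁ x∈⁅a⁆ = x∈⁅y⁆⇒x≡y a x∈⁅a⁆
  ... | inj₂ x∈∁D₁-s = contradiction x∈D₁ (x∈∁p⇒x∉p (proj₁ (x∈p─q⁻ (∁ D₁) ⁅ s ⁆ x∈∁D₁-s)))

  ∉D₁⇒∈D₂ : ∀ {x} → x ∉ D₁ → x ≢ s → x ∈ D₂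
  ∉D₁⇒∈D₂ x∉D₁ x≢s = x∈p∪q⁺ (inj₂ (x∈p∧x∉q⇒x∈p─q (x∉p⇒x∈∁p x∉D₁) (x≢y⇒x∉⁅y⁆ x≢s)))

  Swapped : Pred (Subset (2 * n)) 0ℓ
  Swapped A = A ≡ D₁ ⊎ A ≡ D₂ ⊎ A ≡ ∁ D₁ ⊎ A ≡ ∁ D₂

  Swapped? : ∀ A → Dec (Swapped A)
  Swapped? A = A ≟ˢ D₁ ⊎-dec A ≟ˢ D₂ ⊎-dec A ≟ˢ ∁ D₁ ⊎-dec A ≟ˢ ∁ D₂
    where
    _≟ˢ_ : DecidableEquality (Subset (2 * n))
    _≟ˢ_ = ≡-dec _≟ᵇ_

  Swapped-∁ : ∀ {A} → Swapped A → Swapped (∁ A)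
  Swapped-∁ (inj₁ refl)                 = inj₂ (inj₂ (inj₁ refl))
  Swapped-∁ (inj₂ (inj₁ refl))          = inj₂ (inj₂ (inj₂ refl))
  Swapped-∁ (inj₂ (inj₂ (inj₁ refl)))   = inj₁ (∁-involutive D₁)
  Swapped-∁ (inj₂ (inj₂ (inj₂ refl)))   = inj₂ (inj₁ (∁-involutive D₂))

  ∁-Swapped : ∀ {A} → Swapped (∁ A) → Swapped A
  ∁-Swapped {A} = subst Swapped (∁-involutive A) ∘ Swapped-∁

  -- As s ∉ D₁, D₂: the n-sets avoiding s, with D₁ and D₂ traded for their complements.
  σ : Pred (Subset (2 * n)) 0ℓ
  σ A = ∣ A ∣ ≡ n × (s ∉ A × ¬ Swapped A ⊎ s ∈ A × Swapped A)

  σ-card : ∀ {A} → σ A → ∣ A ∣ ≡ n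
  σ-card = proj₁

  σ⊎σ∁ : ∀ {A} → ∣ A ∣ ≡ n → σ A ⊎ σ (∁ A)
  σ⊎σ∁ {A} ∣A∣≡n with s ∈? A | Swapped? A
  ... | yes s∈A | yes swapped = inj₁ (∣A∣≡n , inj₂ (s∈A , swapped))
  ... | no  s∉A | no  unswapped = inj₁ (∣A∣≡n , inj₁ (s∉A , unswapped))
  ... | yes s∈A | no  unswapped = inj₂ (∣p∣≡n⇒∣∁p∣≡n A ∣A∣≡n , inj₁ (x∈p⇒x∉∁p s∈A , unswapped ∘ ∁-Swapped))
  ... | no  s∉A | yes swapped = inj₂ (∣p∣≡n⇒∣∁p∣≡n A ∣A∣≡n , inj₂ (x∉p⇒x∈∁p s∉A , Swapped-∁ swapped))

  σ⇒¬σ∁ : ∀ {A} → σ A → ¬ σ (∁ A)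
  σ⇒¬σ∁ (_ , inj₁ (s∉A , _))         (_ , inj₁ (s∉∁A , _))       = s∉∁A (x∉p⇒x∈∁p s∉A)
  σ⇒¬σ∁ (_ , inj₁ (_ , unswapped))   (_ , inj₂ (_ , swapped∁))   = unswapped (∁-Swapped swapped∁)
  σ⇒¬σ∁ (_ , inj₂ (_ , swapped))     (_ , inj₁ (_ , unswapped∁)) = unswapped∁ (Swapped-∁ swapped)
  σ⇒¬σ∁ (_ , inj₂ (s∈A , _))         (_ , inj₂ (s∈∁A , _))       = x∈∁p⇒x∉p s∈∁A s∈A

  σ[∁D₁] : σ (∁ D₁)
  σ[∁D₁] = ∣∁D₁∣≡n , inj₂ (x∉p⇒x∈∁p s∉D₁ , inj₂ (inj₂ (inj₁ refl)))

  σ[∁D₂] : σ (∁ D₂)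
  σ[∁D₂] = ∣p∣≡n⇒∣∁p∣≡n D₂ ∣D₂∣≡n , inj₂ (x∉p⇒x∈∁p s∉D₂ , inj₂ (inj₂ (inj₂ refl)))

  σ⁺ : ∀ {A y₁ y₂} → ∣ A ∣ ≡ n → s ∉ A → y₁ ∈ A → y₁ ∈ D₁ → y₁ ≢ a → y₂ ∈ A → y₂ ∈ ∁ D₁ → σ A
  σ⁺ {A} ∣A∣≡n s∉A y₁∈A y₁∈D₁ y₁≢a y₂∈A y₂∈∁D₁ = ∣A∣≡n , inj₁ (s∉A , unswapped)
    where
    unswapped : ¬ Swapped A
    unswapped (inj₁ refl)               = x∈∁p⇒x∉p y₂∈∁D₁ y₂∈A
    unswapped (inj₂ (inj₁ refl))        = y₁≢a (∈D₁∩D₂⇒≡a y₁∈D₁ y₁∈A)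
    unswapped (inj₂ (inj₂ (inj₁ refl))) = s∉A (x∉p⇒x∈∁p s∉D₁)
    unswapped (inj₂ (inj₂ (inj₂ refl))) = s∉A (x∉p⇒x∈∁p s∉D₂)

  ∃-member-between : ∀ {E R} → E ⊆ R - s → 2 + ∣ E ∣ ≤ n → n < ∣ R ∣ →
                     (∃ λ y₁ → y₁ ∈ R × y₁ ∈ D₁ × y₁ ≢ a) →
                     (∃ λ y₂ → y₂ ∈ R × y₂ ∈ ∁ D₁ × y₂ ≢ s) →
                     ∃ λ A → σ A × E ⊆ A × A ⊆ R
  ∃-member-between {E} {R} E⊆R-s 2+∣E∣≤n n<∣R∣ (y₁ , y₁∈R , y₁∈D₁ , y₁≢a) (y₂ , y₂∈R , y₂∈∁D₁ , y₂≢s) =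
    member (∃-subset-between n P⊆R-s ∣P∣≤n n≤∣R-s∣)
    where
    P : Subset (2 * n)
    P = ⁅ y₁ ⁆ ∪ ⁅ y₂ ⁆ ∪ E
    P⊆R-s : P ⊆ R - s
    P⊆R-s = ∪-lub (x∈p⇒⁅x⁆⊆p (x∈p∧x≢y⇒x∈p-y y₁∈R λ { refl → s∉D₁ y₁∈D₁ }))
           (∪-lub (x∈p⇒⁅x⁆⊆p (x∈p∧x≢y⇒x∈p-y y₂∈R y₂≢s)) E⊆R-s)
    ∣P∣≤n : ∣ P ∣ ≤ n
    ∣P∣≤n = begin
      ∣ P ∣                               ≤⟨ ∣p∪q∣≤∣p∣+∣q∣ ⁅ y₁ ⁆ (⁅ y₂ ⁆ ∪ E) ⟩
      ∣ ⁅ y₁ ⁆ ∣ + ∣ ⁅ y₂ ⁆ ∪ E ∣         ≤⟨ +-monoʳ-≤ ∣ ⁅ y₁ ⁆ ∣ (∣p∪q∣≤∣p∣+∣q∣ ⁅ y₂ ⁆ E) ⟩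
      ∣ ⁅ y₁ ⁆ ∣ + (∣ ⁅ y₂ ⁆ ∣ + ∣ E ∣)   ≡⟨ cong₂ (λ i j → i + (j + ∣ E ∣)) (∣⁅x⁆∣≡1 y₁) (∣⁅x⁆∣≡1 y₂) ⟩
      2 + ∣ E ∣                           ≤⟨ 2+∣E∣≤n ⟩
      n                                   ∎
      where open ≤-Reasoning
    n≤∣R-s∣ : n ≤ ∣ R - s ∣
    n≤∣R-s∣ = ≤-pred (≤-trans n<∣R∣ (∣p∣≤1+∣p-x∣ R s))
    member : (∃ λ A → P ⊆ A × A ⊆ R - s × ∣ A ∣ ≡ n) → ∃ λ A → σ A × E ⊆ A × A ⊆ R
    member (A , P⊆A , A⊆R-s , ∣A∣≡n) =
      A , σ⁺ ∣A∣≡n s∉A (P⊆A y₁∈P) y₁∈D₁ y₁≢a (P⊆A y₂∈P) y₂∈∁D₁ , E⊆A , p─q⊆p R ⁅ s ⁆ ∘ A⊆R-s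
      where
      s∉A : s ∉ A
      s∉A s∈A = proj₂ (x∈p─q⁻ R ⁅ s ⁆ (A⊆R-s s∈A)) (x∈⁅x⁆ s)
      y₁∈P : y₁ ∈ P
      y₁∈P = x∈p∪q⁺ (inj₁ (x∈⁅x⁆ y₁))
      y₂∈P : y₂ ∈ P
      y₂∈P = x∈p∪q⁺ (inj₂ (x∈p∪q⁺ (inj₁ (x∈⁅x⁆ y₂))))
      E⊆A : E ⊆ A
      E⊆A = P⊆A ∘ x∈p∪q⁺ ∘ inj₂ ∘ x∈p∪q⁺ ∘ inj₂

  ∃-member⊆ : 2 ≤ n → ∀ R → n < ∣ R ∣ → ∃ λ A → σ A × A ⊆ R
  ∃-member⊆ 2≤n R n<∣R∣
    with any? (λ y → y ∈? R ×-dec y ∈? D₁ ×-dec ¬? (y ≟ᶠ a))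
       | any? (λ y → y ∈? R ×-dec y ∈? ∁ D₁ ×-dec ¬? (y ≟ᶠ s))
  ... | yes y₁ | yes y₂
    with A , σA , _ , A⊆R ← ∃-member-between ⊥⊆ (subst (λ k → 2 + k ≤ n) (sym (∣⊥∣≡0 (2 * n))) 2≤n) n<∣R∣ y₁ y₂
    = A , σA , A⊆R
  ... | _ | no ∄y₂ = ∁ D₂ , σ[∁D₂] , ⁅s⁆∪D₁⊆R ∘ ∈⁅s⁆∪D₁ ∘ ∁D₂-outside
    where
    ∈⁅s⁆∪D₁ : ∀ {y} → ¬ (y ∈ ∁ D₁ × y ≢ s) → y ∈ ⁅ s ⁆ ∪ D₁
    ∈⁅s⁆∪D₁ {y} neither with y ∈? D₁ | y ≟ᶠ s
    ... | yes y∈D₁ | _        = x∈p∪q⁺ (inj₂ y∈D₁)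
    ... | no  _    | yes refl = x∈p∪q⁺ (inj₁ (x∈⁅x⁆ s))
    ... | no  y∉D₁ | no  y≢s  = contradiction (x∉p⇒x∈∁p y∉D₁ , y≢s) neither
    ∁D₂-outside : ∀ {y} → y ∈ ∁ D₂ → ¬ (y ∈ ∁ D₁ × y ≢ s)
    ∁D₂-outside y∈∁D₂ (y∈∁D₁ , y≢s) = x∈∁p⇒x∉p y∈∁D₂ (∉D₁⇒∈D₂ (x∈∁p⇒x∉p y∈∁D₁) y≢s)
    ⁅s⁆∪D₁⊆R : ⁅ s ⁆ ∪ D₁ ⊆ R
    ⁅s⁆∪D₁⊆R = q⊆⁅x⁆∪p⇒∣p∣<∣q∣⇒⁅x⁆∪p⊆q s∉D₁
                 (λ {y} y∈R → ∈⁅s⁆∪D₁ λ (y∈∁D₁ , y≢s) → ∄y₂ (y , y∈R , y∈∁D₁ , y≢s))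
                 (subst (_< ∣ R ∣) (sym ∣D₁∣≡n) n<∣R∣)
  ... | no ∄y₁ | _ = ∁ D₁ , σ[∁D₁] , ⁅a⁆∪∁D₁⊆R ∘ q⊆p∪q ⁅ a ⁆ (∁ D₁)
    where
    R⊆⁅a⁆∪∁D₁ : R ⊆ ⁅ a ⁆ ∪ ∁ D₁
    R⊆⁅a⁆∪∁D₁ {y} y∈R with y ∈? D₁ | y ≟ᶠ a
    ... | no  y∉D₁ | _        = x∈p∪q⁺ (inj₂ (x∉p⇒x∈∁p y∉D₁))
    ... | yes _    | yes refl = x∈p∪q⁺ (inj₁ (x∈⁅x⁆ a))
    ... | yes y∈D₁ | no  y≢a  = contradiction (y , y∈R , y∈D₁ , y≢a) ∄y₁
    ⁅a⁆∪∁D₁⊆R : ⁅ a ⁆ ∪ ∁ D₁ ⊆ R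
    ⁅a⁆∪∁D₁⊆R = q⊆⁅x⁆∪p⇒∣p∣<∣q∣⇒⁅x⁆∪p⊆q (x∈p⇒x∉∁p a∈D₁) R⊆⁅a⁆∪∁D₁
                  (subst (_< ∣ R ∣) (sym ∣∁D₁∣≡n) n<∣R∣)

  ∃-member∋a : 3 ≤ n → ∃ λ A → σ A × a ∈ A
  ∃-member∋a 3≤n = contains-a (∃-member-between ⁅a⁆⊆⊤-s 2+∣⁅a⁆∣≤n n<∣⊤∣
                                 (in-⊤ (1<∣p∣⇒∃[y∈p]y≢x a 1<∣D₁∣)) (in-⊤ (1<∣p∣⇒∃[y∈p]y≢x s 1<∣∁D₁∣)))
    where
    1<n : 1 < n
    1<n = ≤-trans (s≤s (s≤s z≤n)) 3≤n
    1<∣D₁∣ : 1 < ∣ D₁ ∣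
    1<∣D₁∣ = subst (1 <_) (sym ∣D₁∣≡n) 1<n
    1<∣∁D₁∣ : 1 < ∣ ∁ D₁ ∣
    1<∣∁D₁∣ = subst (1 <_) (sym ∣∁D₁∣≡n) 1<n
    ⁅a⁆⊆⊤-s : ⁅ a ⁆ ⊆ ⊤ - s
    ⁅a⁆⊆⊤-s = x∈p⇒⁅x⁆⊆p (x∈p∧x≢y⇒x∈p-y ∈⊤ λ { refl → s∉D₁ a∈D₁ })
    2+∣⁅a⁆∣≤n : 2 + ∣ ⁅ a ⁆ ∣ ≤ n
    2+∣⁅a⁆∣≤n = subst (λ k → 2 + k ≤ n) (sym (∣⁅x⁆∣≡1 a)) 3≤n
    n<∣⊤∣ : n < ∣ ⊤ {2 * n} ∣
    n<∣⊤∣ = subst (n <_) (sym (∣⊤∣≡n (2 * n))) (m<m+n n (≤-trans (<⇒≤ 1<n) (m≤m+n n 0)))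
    in-⊤ : ∀ {p : Subset (2 * n)} {x} → (∃ λ y → y ∈ p × y ≢ x) → ∃ λ y → y ∈ ⊤ × y ∈ p × y ≢ x
    in-⊤ (y , y∈p , y≢x) = y , ∈⊤ , y∈p , y≢x
    contains-a : (∃ λ A → σ A × ⁅ a ⁆ ⊆ A × A ⊆ ⊤) → ∃ λ A → σ A × a ∈ A
    contains-a (A , σA , ⁅a⁆⊆A , _) = A , σA , ⁅a⁆⊆A (x∈⁅x⁆ a)

  σ-covers : 3 ≤ n → ∀ x → ∃ λ A → σ A × x ∈ A
  σ-covers 3≤n x with x ∈? D₁ | x ∈? D₂
  ... | no  x∉D₁ | _        = ∁ D₁ , σ[∁D₁] , x∉p⇒x∈∁p x∉D₁
  ... | yes _    | no  x∉D₂ = ∁ D₂ , σ[∁D₂] , x∉p⇒x∈∁p x∉D₂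
  ... | yes x∈D₁ | yes x∈D₂ rewrite ∈D₁∩D₂⇒≡a x∈D₁ x∈D₂ = ∃-member∋a 3≤n

lemma3p4 : (n m : ℕ) → 3 ≤ n → 2 * n ≤ m →
    (ι : Fin (2 * n) → Fin m) → Injective _≡_ _≡_ ι →
    Σ (Pred (Subset (2 * n)) 0ℓ) λ σ →
      IsAntipodeFreeMax n (2 * (n ∸ 1)) σ
      × IsMaximalVRSimplex n (2 * (n ∸ 1)) Full (jImage ι σ)
      × (∀ (τ : Pred (Subset m) 0ℓ) →
           (IsVRSimplex n (2 * (n ∸ 1)) (Union (jImage ι σ)) τ →
              IsVRSimplex n (2 * (n ∸ 1)) (RangeOf ι) τ)
           × (IsVRSimplex n (2 * (n ∸ 1)) (RangeOf ι) τ →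
              IsVRSimplex n (2 * (n ∸ 1)) (Union (jImage ι σ)) τ))
lemma3p4 n m 3≤n _ ι ι-injective
  with 1≤n ← ≤-trans (s≤s z≤n) 3≤n
  with D₁ , ∣D₁∣≡n , (a , a∈D₁) , (s , s∈∁D₁) ← ∃-half n 1≤n
  = σ , (σ-simplex , exactly-one) , jσ-maximal , λ τ → IsVRSimplex-mono Union-jImage⇒RangeOf ,
                                                        IsVRSimplex-mono (RangeOf⇒Union-jImage (σ-covers 3≤n))
  where
  open SwappedStar a∈D₁ (x∈∁p⇒x∉p s∈∁D₁) ∣D₁∣≡n
  open Antipodal {σ = σ} σ-card σ⊎σ∁ σ⇒¬σ∁
  σ-simplex : IsVRSimplex n (2 * (n ∸ 1)) Full σ
  σ-simplex = intersecting⇒IsVRSimplex (∁ D₁ , σ[∁D₁]) (λ _ σA → σ-card σA , _) intersecting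
  jσ-simplex : IsVRSimplex n (2 * (n ∸ 1)) Full (jImage ι σ)
  jσ-simplex = intersecting⇒IsVRSimplex (_ , ∁ D₁ , σ[∁D₁] , IsImage-image ι (∁ D₁))
                 (λ _ jB → jImage-card ι-injective σ-card jB , _) (jImage-intersecting intersecting)
  jσ-maximal : IsMaximalVRSimplex n (2 * (n ∸ 1)) Full (jImage ι σ)
  jσ-maximal = far-outsiders⇒IsMaximalVRSimplex jσ-simplex
                 (jImage-outsiders-far ι-injective σ-card 1≤n (∃-member⊆∁ (∃-member⊆ (≤-trans (n≤1+n 2) 3≤n))))
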